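{- Each of the two cubic graphs of order $6$, namely the complete bipartite graph $K_{3,3}$ and the triangular prism $K_3\square K_2$, has fair coalition number $6$.
   Context: All graphs are finite and simple, $G=(V,E)$. A cubic graph is a 3-regular graph. For an integer $k\geq 1$, a $k$-fair dominating set of $G$ is a set $D\subseteq V$ such that every vertex $v\in V\setminus D$ satisfies $|N(v)\cap D|=k$. A fair dominating set is a $k$-fair dominating set for some $k\geq 1$. A fair coalition consists of two disjoint sets $A_1,A_2\subseteq V$, neither of which is a fair dominating set, whose union $A_1\cup A_2$ is a fair dominating set. A fair coalition partition ($fc$-partition) of $G$ is a partition $\Upsilon=\{A_1,\dots,A_k\}$ of $V$ such that every $A_i$ is either a singleton fair dominating set of $G$, or is not a fair dominating set and forms a fair coalition with some other non-fair-dominating set $A_j\in\Upsilon$. The fair coalition number $\mathcal{C}_f(G)$ is the maximum number of sets in an $fc$-partition of $G$. -}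

module Defs where

open import Data.Bool using (Bool; true; false; _∧_; _∨_; not; _xor_; if_then_else_)
open import Data.Bool.Properties using (∧-comm; ∨-comm)
open import Data.Nat using (ℕ; zero; suc; _+_; _*_; _≤_)
open import Data.Fin using (Fin; _≟_; splitAt; remQuot)
open import Data.Sum using (_⊎_; inj₁; inj₂)
open import Data.Product using (Σ; ∃; ∃-syntax; _×_; _,_; proj₁; proj₂)
open import Data.List using (List; map)
open import Data.Nat.ListAction using (sum)
open import Data.List using () renaming (allFin to allFinL)
open import Relation.Nullary using (¬_; yes; no)
open import Relation.Nullary.Decidable using (⌊_⌋)
open import Relation.Binary.PropositionalEquality using (_≡_; _≢_; refl; sym)

record Graph (n : ℕ) : Set where
  field
    adj     : Fin n → Fin n → Bool
    adj-sym : ∀ u v → adj u v ≡ adj v u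
    loopless : ∀ v → adj v v ≡ false
open Graph public

eqᵇ : {n : ℕ} → Fin n → Fin n → Bool
eqᵇ u v = ⌊ u ≟ v ⌋

eqᵇ-sym : {n : ℕ} (u v : Fin n) → eqᵇ u v ≡ eqᵇ v u
eqᵇ-sym u v with u ≟ v | v ≟ u
... | yes _ | yes _ = refl
... | yes p | no q = Data.Empty.⊥-elim (q (sym p))
  where import Data.Empty
... | no p | yes q = Data.Empty.⊥-elim (p (sym q))
  where import Data.Empty
... | no _ | no _ = refl

eqᵇ-refl : {n : ℕ} (u : Fin n) → eqᵇ u u ≡ true
eqᵇ-refl u with u ≟ u
... | yes _ = refl
... | no p = Data.Empty.⊥-elim (p refl)
  where import Data.Empty

K : (n : ℕ) → Graph n
K n = record
  { adj = λ u v → not (eqᵇ u v)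
  ; adj-sym = λ u v → Relation.Binary.PropositionalEquality.cong not (eqᵇ-sym u v)
  ; loopless = λ v → Relation.Binary.PropositionalEquality.cong not (eqᵇ-refl v)
  }

side : {m n : ℕ} → Fin (m + n) → Bool
side {m} u with splitAt m u
... | inj₁ _ = true
... | inj₂ _ = false

xor-comm : ∀ a b → a xor b ≡ b xor a
xor-comm true true = refl
xor-comm true false = refl
xor-comm false true = refl
xor-comm false false = refl

xor-self : ∀ a → a xor a ≡ false
xor-self true = refl
xor-self false = refl

KBip : (m n : ℕ) → Graph (m + n)
KBip m n = record
  { adj = λ u v → side {m} {n} u xor side {m} {n} v
  ; adj-sym = λ u v → xor-comm (side {m} {n} u) (side {m} {n} v)
  ; loopless = λ v → xor-self (side {m} {n} v)
  }

-- Cartesian product G □ H on Fin (m * n); a vertex x corresponds to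
-- the pair remQuot n x = (a , b) with a : Fin m, b : Fin n.
pairAdj : {m n : ℕ} → Graph m → Graph n → Fin m × Fin n → Fin m × Fin n → Bool
pairAdj G H (a , b) (c , d) = (eqᵇ a c ∧ adj H b d) ∨ (adj G a c ∧ eqᵇ b d)

pairAdj-sym : {m n : ℕ} (G : Graph m) (H : Graph n) (p q : Fin m × Fin n) →
              pairAdj G H p q ≡ pairAdj G H q p
pairAdj-sym G H (a , b) (c , d)
  rewrite eqᵇ-sym a c | adj-sym H b d | adj-sym G a c | eqᵇ-sym b d = refl

pairAdj-loop : {m n : ℕ} (G : Graph m) (H : Graph n) (p : Fin m × Fin n) →
               pairAdj G H p p ≡ false
pairAdj-loop G H (a , b)
  rewrite eqᵇ-refl a | eqᵇ-refl b | loopless H b | loopless G a = refl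

□-adj : {m n : ℕ} → Graph m → Graph n → Fin (m * n) → Fin (m * n) → Bool
□-adj {m} {n} G H x y = pairAdj G H (remQuot {m} n x) (remQuot {m} n y)

_□_ : {m n : ℕ} → Graph m → Graph n → Graph (m * n)
G □ H = record
  { adj = □-adj G H
  ; adj-sym = λ x y → pairAdj-sym G H (remQuot _ x) (remQuot _ y)
  ; loopless = λ x → pairAdj-loop G H (remQuot _ x)
  }

K₃,₃ : Graph 6
K₃,₃ = KBip 3 3

Prism : Graph 6
Prism = K 3 □ K 2

VSet : ℕ → Set
VSet n = Fin n → Bool

_∪_ : {n : ℕ} → VSet n → VSet n → VSet n
(A ∪ B) v = A v ∨ B v

count : {n : ℕ} → (Fin n → Bool) → ℕ
count {n} P = sum (map (λ v → if P v then 1 else 0) (allFinL n))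

nbrsIn : {n : ℕ} → Graph n → VSet n → Fin n → ℕ
nbrsIn G D v = count (λ u → adj G v u ∧ D u)

IsKFairDom : {n : ℕ} → Graph n → ℕ → VSet n → Set
IsKFairDom G k D = ∀ v → D v ≡ false → nbrsIn G D v ≡ k

IsFairDom : {n : ℕ} → Graph n → VSet n → Set
IsFairDom G D = ∃[ k ] (1 ≤ k × IsKFairDom G k D)

IsSingleton : {n : ℕ} → VSet n → Set
IsSingleton {n} A = ∃[ v ] (∀ u → (A u ≡ true) → u ≡ v) × (A v ≡ true)

-- Partitions of Fin n into exactly k (nonempty) blocks, given by a
-- surjective labelling Fin n → Fin k; block i = { v | f v = i }.

record Partition (n k : ℕ) : Set where
  field
    label : Fin n → Fin k
    surj  : ∀ i → ∃[ v ] label v ≡ i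
open Partition public

block : {n k : ℕ} → Partition n k → Fin k → VSet n
block P i v = eqᵇ (label P v) i

-- fair coalition: disjoint A, B, neither fair dominating, union fair dominating
-- (disjointness of distinct blocks is automatic)
FairCoalition : {n : ℕ} → Graph n → VSet n → VSet n → Set
FairCoalition G A B = ¬ IsFairDom G A × ¬ IsFairDom G B × IsFairDom G (A ∪ B)

IsFCPartition : {n k : ℕ} → Graph n → Partition n k → Set
IsFCPartition {n} {k} G P =
  ∀ (i : Fin k) →
    (IsSingleton (block P i) × IsFairDom G (block P i))
    ⊎ (¬ IsFairDom G (block P i) ×
       ∃[ j ] (j ≢ i × FairCoalition G (block P i) (block P j)))

HasFCPartition : {n : ℕ} → Graph n → ℕ → Set
HasFCPartition {n} G k = Σ (Partition n k) (IsFCPartition G)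

FairCoalitionNumber : {n : ℕ} → Graph n → ℕ → Set
FairCoalitionNumber G c = HasFCPartition G c × (∀ k → HasFCPartition G k → k ≤ c)

-- Both graphs carry a perfect matching whose every edge {u, v} is a 1-fair
-- dominating set: each vertex off the edge sees exactly one endpoint (across
-- the two sides of K₃,₃, along the rungs of the prism).  No singleton is fair
-- dominating, since a cubic graph on six vertices leaves two vertices outside
-- every closed neighbourhood.  Hence the partition into singletons, each in
-- coalition with its matching partner, is an fc-partition with six blocks,
-- which is the most any partition of six vertices can have.
module Submission where

open import Defs
open import Data.Bool using (false)
open import Data.Bool.Properties using () renaming (_≟_ to _≟ᵇ_)
open import Data.Fin using (Fin) renaming (_≟_ to _≟ᶠ_)
open import Data.Fin.Patterns using (0F; 1F; 2F; 3F; 4F; 5F)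
open import Data.Fin.Properties using (all?; any?; injective⇒≤)
open import Data.Nat using (ℕ; _≤_; s≤s; z≤n) renaming (_≟_ to _≟ℕ_)
open import Data.Product using (∃-syntax; _×_; _,_; proj₁; proj₂)
open import Data.Sum using (inj₂)
open import Function using (id)
open import Relation.Binary.PropositionalEquality using (_≡_; _≢_; refl; sym; trans; cong)
open import Relation.Nullary using (¬_; Dec; ¬?)
open import Relation.Nullary.Decidable using (_×-dec_; _→-dec_; toWitness)

private
  variable
    n k : ℕ

blocks≤vertices : Partition n k → k ≤ n
blocks≤vertices P = injective⇒≤ representative-injective
  where
  representative-injective : ∀ {i j} → proj₁ (surj P i) ≡ proj₁ (surj P j) → i ≡ j
  representative-injective {i} {j} e =
    trans (sym (proj₂ (surj P i))) (trans (cong (label P) e) (proj₂ (surj P j)))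

fcPartition≤order : (G : Graph n) → HasFCPartition G k → k ≤ n
fcPartition≤order G (P , _) = blocks≤vertices P

HasUndominated : Graph n → VSet n → Set
HasUndominated G D = ∃[ w ] (D w ≡ false × nbrsIn G D w ≡ 0)

undominated⇒¬fairDom : (G : Graph n) (D : VSet n) → HasUndominated G D → ¬ IsFairDom G D
undominated⇒¬fairDom G D (w , w∉D , none) (k , 1≤k , fair) with trans (sym none) (fair w w∉D)
undominated⇒¬fairDom G D _ (.0 , () , _) | refl

singletons : (n : ℕ) → Partition n n
singletons n = record { label = id ; surj = λ i → i , refl }

singleton : Fin n → VSet n
singleton = block (singletons _)

FairMatching : Graph n → (Fin n → Fin n) → Set
FairMatching G partner =
  ∀ i → partner i ≢ i
      × HasUndominated G (singleton i)
      × IsKFairDom G 1 (singleton i ∪ singleton (partner i))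

fairMatching? : (G : Graph n) (partner : Fin n → Fin n) → Dec (FairMatching G partner)
fairMatching? G partner = all? λ i →
  ¬? (partner i ≟ᶠ i)
  ×-dec any? (λ w → (singleton i w ≟ᵇ false) ×-dec (nbrsIn G (singleton i) w ≟ℕ 0))
  ×-dec all? (λ v → (D i v ≟ᵇ false) →-dec (nbrsIn G (D i) v ≟ℕ 1))
  where
  D : Fin _ → VSet _
  D i = singleton i ∪ singleton (partner i)

fairMatching⇒fcPartition : (G : Graph n) (partner : Fin n → Fin n) →
  FairMatching G partner → HasFCPartition G n
fairMatching⇒fcPartition G partner matching = singletons _ , λ i →
  let (partner≢ , undominated , pairFair) = matching i in
  inj₂ ( ¬fairDom i , partner i , partner≢
       , ¬fairDom i , ¬fairDom (partner i) , (1 , s≤s z≤n , pairFair))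
  where
  ¬fairDom : ∀ i → ¬ IsFairDom G (singleton i)
  ¬fairDom i = undominated⇒¬fairDom G _ (proj₁ (proj₂ (matching i)))

fairMatching⇒coalitionNumber : (G : Graph n) (partner : Fin n → Fin n) →
  FairMatching G partner → FairCoalitionNumber G n
fairMatching⇒coalitionNumber G partner matching =
  fairMatching⇒fcPartition G partner matching , λ _ → fcPartition≤order G

acrossSides : Fin 6 → Fin 6
acrossSides 0F = 3F
acrossSides 1F = 4F
acrossSides 2F = 5F
acrossSides 3F = 0F
acrossSides 4F = 1F
acrossSides 5F = 2F

-- Vertex 2a + b of the prism is (a , b) ∈ Fin 3 × Fin 2.
alongRung : Fin 6 → Fin 6
alongRung 0F = 1F
alongRung 1F = 0F
alongRung 2F = 3F
alongRung 3F = 2F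
alongRung 4F = 5F
alongRung 5F = 4F

K₃,₃-fairMatching : FairMatching K₃,₃ acrossSides
K₃,₃-fairMatching = toWitness {a? = fairMatching? K₃,₃ acrossSides} _

Prism-fairMatching : FairMatching Prism alongRung
Prism-fairMatching = toWitness {a? = fairMatching? Prism alongRung} _

mainTheorem6 : FairCoalitionNumber K₃,₃ 6 × FairCoalitionNumber Prism 6
mainTheorem6 = fairMatching⇒coalitionNumber K₃,₃ acrossSides K₃,₃-fairMatching
             , fairMatching⇒coalitionNumber Prism alongRung Prism-fairMatching
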